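{- Let $\mathit{Act}$ be a set of actions containing the silent action $\tau$, and let $\mathcal{A}$ be the boolean algebra $(\mathcal{P}(\mathit{Act}),+,\cdot,\bar{\ },0,1)$, where $+$ is union, $\cdot$ is intersection, $0=\emptyset$ and $1=\mathit{Act}$. Let $(\sigma,A,S,\rho)$ be a transition system of dimension $n$ with silent steps, i.e. $\sigma\in\{0,1\}^{1\times n}$ has exactly one non-zero entry, $A\in\mathcal{A}^{n\times n}$ satisfies $\{\tau\}\cdot A=0$ (no entry of $A$ contains $\tau$), $S\in\{0,1\}^{n\times n}$ is a $0$--$1$ matrix, and $\rho\in\{0,1\}^{n\times 1}$. Let $\Pi=S^*=\sum_{k\ge 0}S^k$. Let $V\in\{0,1\}^{n\times N}$ be a collector matrix that is a weak bisimulation on $(\sigma,A,S,\rho)$, i.e. there is a distributor $U$ for $V$ such that \[VU\Pi V=\Pi V,\qquad VU\Pi A\Pi V=\Pi A\Pi V,\qquad VU\Pi\rho=\Pi\rho.\] Then, writing $V^{T}$ for the transpose of $V$, \[V^{T}\Pi V=(V^{T}SV)^*\qquad\text{and}\qquad \Pi VV^{T}=\Pi VV^{T}\Pi.\]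
   Context: All matrices have entries in $\mathcal{A}$ (the $0$--$1$ matrices are those with entries in $\{0,1\}=\{\emptyset,\mathit{Act}\}$), and matrix sum and product are defined as usual with $+$ and $\cdot$ of $\mathcal{A}$, i.e. $(XY)[i,j]=\sum_k X[i,k]\cdot Y[k,j]$; $\le$ on matrices is entrywise inclusion. For a $0$--$1$ square matrix $R$, its reflexive-transitive closure is $R^*=\sum_{k\ge0}R^k$ with $R^0=I$ the identity matrix. A collector is a $0$--$1$ matrix $V\in\{0,1\}^{n\times N}$, $n\ge N$, in which every row contains exactly one $1$. A distributor for $V$ is a matrix $U\in\mathcal{A}^{N\times m}$ with $U\mathbf{1}=\mathbf{1}$ (where $\mathbf{1}$ is the all-ones column vector) and $UV=I^N$. -}

module Defs where

open import Data.Nat using (ℕ; zero; suc; _≥_)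
open import Data.Fin using (Fin)
open import Data.Bool using (Bool; true; false; T)
open import Data.Unit using (⊤)
open import Data.Empty using (⊥)
open import Data.Sum using (_⊎_)
open import Data.Product using (Σ; ∃; ∃-syntax; _×_; _,_)
open import Function.Bundles using (_⇔_)
open import Relation.Nullary using (¬_)
open import Relation.Binary.PropositionalEquality using (_≡_)

-- The boolean algebra 𝒜 = 𝒫(Act): subsets of Act as predicates.
𝒜 : Set → Set₁
𝒜 Act = Act → Set

Mat : Set → ℕ → ℕ → Set₁
Mat Act r c = Fin r → Fin c → 𝒜 Act

BMat : ℕ → ℕ → Set
BMat r c = Fin r → Fin c → Bool

-- embedding of a 0–1 matrix into 𝒜-matrices: true ↦ Act, false ↦ ∅
⌜_⌝ : ∀ {Act r c} → BMat r c → Mat Act r c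
⌜ B ⌝ i j a = T (B i j)

infixl 6 _⊕_
infixl 7 _⊙_
infix 4 _≋_

_⊕_ : ∀ {Act r c} → Mat Act r c → Mat Act r c → Mat Act r c
(X ⊕ Y) i j a = X i j a ⊎ Y i j a

_⊙_ : ∀ {Act r m c} → Mat Act r m → Mat Act m c → Mat Act r c
(X ⊙ Y) i j a = ∃[ k ] (X i k a × Y k j a)

I : ∀ {Act} n → Mat Act n n
I n i j a = i ≡ j

𝟏 : ∀ {Act} r → Mat Act r 1
𝟏 r i j a = ⊤

_ᵀ : ∀ {Act r c} → Mat Act r c → Mat Act c r
(X ᵀ) i j = X j i

_^_ : ∀ {Act n} → Mat Act n n → ℕ → Mat Act n n
_^_ {n = n} R zero = I n
R ^ suc k = R ⊙ (R ^ k)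

_* : ∀ {Act n} → Mat Act n n → Mat Act n n
(R *) i j a = ∃[ k ] ((R ^ k) i j a)

_≋_ : ∀ {Act r c} → Mat Act r c → Mat Act r c → Set
X ≋ Y = ∀ i j a → X i j a ⇔ Y i j a

ExactlyOne : ∀ {c} → (Fin c → Bool) → Set
ExactlyOne {c} f = ∃[ j ] (f j ≡ true × (∀ j' → f j' ≡ true → j' ≡ j))

IsCollector : ∀ {n N} → BMat n N → Set
IsCollector {n} {N} V = n ≥ N × (∀ i → ExactlyOne (V i))

IsDistributor : ∀ {Act n N} → BMat n N → Mat Act N n → Set
IsDistributor {N = N} V U = (U ⊙ 𝟏 _ ≋ 𝟏 N) × (U ⊙ ⌜ V ⌝ ≋ I N)

IsTSSilent : ∀ {Act} (τ : Act) {n} → BMat 1 n → Mat Act n n → BMat n n → BMat n 1 → Set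
IsTSSilent τ σ A S ρ = ExactlyOne (σ Data.Fin.zero) × (∀ i j → ¬ A i j τ)

IsWeakBisim : ∀ {Act n N} → BMat 1 n → Mat Act n n → BMat n n → BMat n 1 → BMat n N → Set₁
IsWeakBisim {Act} σ A S ρ V =
  let Π = ⌜ S ⌝ * ; V′ = ⌜ V ⌝ in
  Σ (Mat Act _ _) λ U →
    IsDistributor V U
    × (V′ ⊙ U ⊙ Π ⊙ V′ ≋ Π ⊙ V′)
    × (V′ ⊙ U ⊙ Π ⊙ A ⊙ Π ⊙ V′ ≋ Π ⊙ A ⊙ Π ⊙ V′)
    × (V′ ⊙ U ⊙ Π ⊙ ⌜ ρ ⌝ ≋ Π ⊙ ⌜ ρ ⌝)

⌜_⌝[_] : ∀ {r c} → BMat r c → (Act : Set) → Mat Act r c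
⌜ B ⌝[ Act ] = ⌜ B ⌝

-- Write c(i) for the unique class of state i under the collector V.  The first
-- bisimulation equation VUΠV = ΠV says that row i of ΠV is row c(i) of UΠV, so
-- whether a state silently reaches class q depends only on its class.  Hence a
-- path in the quotient VᵀSV, whose consecutive S-steps start from possibly
-- different members of a class, can be realised by a single S*-path from any
-- member of its first class; conversely every S-path projects to a quotient
-- path.  This gives VᵀΠV = (VᵀSV)*, with surjectivity of c (from UV = I and
-- U𝟏 = 𝟏) needed for the empty-class case.  The same class invariance yields
-- ΠVVᵀΠ ≤ ΠVVᵀ: after reaching a member of the class of m, the Π-step from m
-- can be replayed from that member.
module Submission where

open import Defs
open import Data.Nat using (ℕ; zero; suc)
open import Data.Fin using (Fin)
open import Data.Bool using (T)
open import Data.Bool.Properties using (T-≡)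
open import Data.Unit using (tt)
open import Data.Product using (_×_; _,_; ∃; proj₁; proj₂)
open import Function.Bundles using (Equivalence; mk⇔)
open import Relation.Binary.PropositionalEquality using (_≡_; refl; sym; trans; subst; subst₂)

module _ {Act : Set} {n : ℕ} {R : Mat Act n n} where

  *-refl : ∀ {i a} → (R *) i i a
  *-refl = zero , refl

  *-step : ∀ {i m j a} → R i m a → (R *) m j a → (R *) i j a
  *-step {m = m} r (k , path) = suc k , m , r , path

  *-trans : ∀ {i m j a} → (R *) i m a → (R *) m j a → (R *) i j a
  *-trans (zero , refl)          q = q
  *-trans (suc k , _ , r , path) q = *-step r (*-trans (k , path) q)

RowIncluded : ∀ {Act r c} → Mat Act r c → Fin r → Fin r → Set
RowIncluded X i i′ = ∀ j a → X i j a → X i′ j a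

⊙-rowIncluded : ∀ {Act r m c} {X : Mat Act r m} {Y : Mat Act m c} {i i′} →
                RowIncluded X i i′ → RowIncluded (X ⊙ Y) i i′
⊙-rowIncluded incl j a (k , x , y) = k , incl k a x , y

≋-rowIncluded : ∀ {Act r c} {X Y : Mat Act r c} {i i′} →
                X ≋ Y → RowIncluded X i i′ → RowIncluded Y i i′
≋-rowIncluded X≋Y incl j a y =
  Equivalence.to (X≋Y _ j a) (incl j a (Equivalence.from (X≋Y _ j a) y))

module Collector {Act : Set} {n N : ℕ} (V : BMat n N) (rows : ∀ i → ExactlyOne (V i)) where

  class : Fin n → Fin N
  class i = proj₁ (rows i)

  ∈-class : ∀ i → T (V i (class i))
  ∈-class i = Equivalence.from T-≡ (proj₁ (proj₂ (rows i)))

  class-unique : ∀ {i p} → T (V i p) → class i ≡ p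
  class-unique {i} v = sym (proj₂ (proj₂ (rows i)) _ (Equivalence.to T-≡ v))

  collector-rowIncluded : ∀ {c} {X : Mat Act N c} {i i′} →
                          class i ≡ class i′ → RowIncluded (⌜ V ⌝ ⊙ X) i i′
  collector-rowIncluded {X = X} {i′ = i′} same j a (k , v , x) =
    class i′ , ∈-class i′ , subst (λ p → X p j a) (trans (sym (class-unique v)) same) x

  distributor-classes-inhabited : ∀ {U : Mat Act N n} → IsDistributor V U →
                                  Act → ∀ p → ∃ λ i → class i ≡ p
  distributor-classes-inhabited (U𝟏≋𝟏 , UV≋I) a p
    with Equivalence.from (U𝟏≋𝟏 p Fin.zero a) tt
  ... | i , upi , _ = i , sym (Equivalence.to (UV≋I p (class i) a) (i , upi , ∈-class i))

  quotient-^ : (R : Mat Act n n) → ∀ k {i l a} → (R ^ k) i l a →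
               (((⌜ V ⌝ ᵀ) ⊙ R ⊙ ⌜ V ⌝) ^ k) (class i) (class l) a
  quotient-^ R zero        refl           = refl
  quotient-^ R (suc k) {i} (m , r , path) =
    class m , (m , (i , ∈-class i , r) , ∈-class m) , quotient-^ R k path

  quotient-* : (R : Mat Act n n) → ∀ {i l a} → (R *) i l a →
               (((⌜ V ⌝ ᵀ) ⊙ R ⊙ ⌜ V ⌝) *) (class i) (class l) a
  quotient-* R (k , path) = k , quotient-^ R k path

module WeakBisimulation {Act : Set} {n N : ℕ} (S : BMat n n) (V : BMat n N)
         (rows : ∀ i → ExactlyOne (V i)) (U : Mat Act N n)
         (VUΠV≋ΠV : ⌜ V ⌝ ⊙ U ⊙ (⌜ S ⌝ *) ⊙ ⌜ V ⌝ ≋ (⌜ S ⌝ *) ⊙ ⌜ V ⌝) where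

  open Collector {Act} V rows

  Π : Mat Act n n
  Π = ⌜ S ⌝ *

  ΠV-class-invariant : ∀ {i i′} → class i ≡ class i′ → RowIncluded (Π ⊙ ⌜ V ⌝) i i′
  ΠV-class-invariant same = ≋-rowIncluded VUΠV≋ΠV
    (⊙-rowIncluded {X = ⌜ V ⌝ ⊙ U ⊙ Π} (⊙-rowIncluded {X = ⌜ V ⌝ ⊙ U}
      (collector-rowIncluded same)))

  ΠV-*-trans : ∀ {i m q a} → Π i m a → (Π ⊙ ⌜ V ⌝) m q a → (Π ⊙ ⌜ V ⌝) i q a
  ΠV-*-trans π (l , π′ , v) = l , *-trans π π′ , v

  lift-^ : ∀ k {p q a} → ((((⌜ V ⌝ ᵀ) ⊙ ⌜ S ⌝ ⊙ ⌜ V ⌝) ^ k) p q a) →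
           ∀ {i} → class i ≡ p → (Π ⊙ ⌜ V ⌝) i q a
  lift-^ zero    refl {i} refl = i , *-refl , ∈-class i
  lift-^ (suc k) (r , (m , (i′ , vi′ , s) , vm) , path) ci≡p =
    ΠV-class-invariant (trans (class-unique vi′) (sym ci≡p)) _ _
      (ΠV-*-trans (*-step s *-refl) (lift-^ k path (class-unique vm)))

  VᵀΠV≋[VᵀSV]* : ∀ {U′ : Mat Act N n} → IsDistributor V U′ →
                 (⌜ V ⌝ ᵀ) ⊙ Π ⊙ ⌜ V ⌝ ≋ ((⌜ V ⌝ ᵀ) ⊙ ⌜ S ⌝ ⊙ ⌜ V ⌝) *
  VᵀΠV≋[VᵀSV]* distributor p q a = mk⇔ collapse expand
    where
      collapse : ((⌜ V ⌝ ᵀ) ⊙ Π ⊙ ⌜ V ⌝) p q a → (((⌜ V ⌝ ᵀ) ⊙ ⌜ S ⌝ ⊙ ⌜ V ⌝) *) p q a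
      collapse (l , (i , vi , π) , vl) =
        subst₂ (λ p q → (((⌜ V ⌝ ᵀ) ⊙ ⌜ S ⌝ ⊙ ⌜ V ⌝) *) p q a)
               (class-unique vi) (class-unique vl) (quotient-* ⌜ S ⌝ π)

      expand : (((⌜ V ⌝ ᵀ) ⊙ ⌜ S ⌝ ⊙ ⌜ V ⌝) *) p q a → ((⌜ V ⌝ ᵀ) ⊙ Π ⊙ ⌜ V ⌝) p q a
      expand (k , path) with distributor-classes-inhabited distributor a p
      ... | i , refl with lift-^ k path refl
      ... | l , π , vl = l , (i , ∈-class i , π) , vl

  ΠVVᵀ≋ΠVVᵀΠ : Π ⊙ ⌜ V ⌝ ⊙ (⌜ V ⌝ ᵀ) ≋ Π ⊙ ⌜ V ⌝ ⊙ (⌜ V ⌝ ᵀ) ⊙ Π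
  ΠVVᵀ≋ΠVVᵀΠ i j a = mk⇔ (λ x → j , x , *-refl) absorb
    where
      absorb : (Π ⊙ ⌜ V ⌝ ⊙ (⌜ V ⌝ ᵀ) ⊙ Π) i j a → (Π ⊙ ⌜ V ⌝ ⊙ (⌜ V ⌝ ᵀ)) i j a
      absorb (m , (p , (l , π , vl) , vm) , π′) =
        class j , ΠV-*-trans π
          (ΠV-class-invariant (trans (class-unique vm) (sym (class-unique vl))) _ _
            (j , π′ , ∈-class j)) , ∈-class j

theorem1 : (Act : Set) (τ : Act) (n N : ℕ)
    (σ : BMat 1 n) (A : Mat Act n n) (S : BMat n n) (ρ : BMat n 1) (V : BMat n N) →
    IsTSSilent τ σ A S ρ → IsCollector V → IsWeakBisim σ A S ρ V →
    ((⌜ V ⌝[ Act ] ᵀ) ⊙ (⌜ S ⌝[ Act ] *) ⊙ ⌜ V ⌝[ Act ]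
    ≋ ((⌜ V ⌝[ Act ] ᵀ) ⊙ ⌜ S ⌝[ Act ] ⊙ ⌜ V ⌝[ Act ]) *)
    × ((⌜ S ⌝[ Act ] *) ⊙ ⌜ V ⌝[ Act ] ⊙ (⌜ V ⌝[ Act ] ᵀ)
    ≋ (⌜ S ⌝[ Act ] *) ⊙ ⌜ V ⌝[ Act ] ⊙ (⌜ V ⌝[ Act ] ᵀ) ⊙ (⌜ S ⌝[ Act ] *))
theorem1 Act τ n N σ A S ρ V _ (_ , rows) (U , distributor , VUΠV≋ΠV , _) =
  VᵀΠV≋[VᵀSV]* distributor , ΠVVᵀ≋ΠVVᵀΠ
  where open WeakBisimulation S V rows U VUΠV≋ΠV
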